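{- Let $N \ge 1$ be a natural number and define the PAFAS process $\mathit{Fifo} \equiv \mathit{Fifo}(0)$ by the defining equations $\mathit{Fifo}(0) \equiv in.\mathit{Fifo}(1)$; $\mathit{Fifo}(i) \equiv in.\mathit{Fifo}(i+1) + out.\mathit{Fifo}(i-1)$ for $0<i<N+2$; $\mathit{Fifo}(N+2) \equiv out.\mathit{Fifo}(N+1)$. Then the asymptotic performance of $\mathit{Fifo}$ is $2$, i.e. $rp_{\mathit{Fifo}}(n) = 2n + \Theta(1)$; moreover, for every $N\ge 1$, $rp_{\mathit{Fifo}}(n) = 2n$ for all $n \ge 1$.
   Context: PAFAS (a timed process algebra). $\mathcal{A}$ is an infinite set of visible actions containing a special success action $\omega$ and the actions $in, out$; $\tau\notin\mathcal{A}$ is the internal action, $\mathcal{A}_\tau=\mathcal{A}\cup\{\tau\}$. For each $\alpha\in\mathcal{A}_\tau$ there is an urgent version $\underline{\alpha}$. A general relabelling function is $\Phi:\mathcal{A}_\tau\to\mathcal{A}_\tau$ with $\Phi(\tau)=\tau$ changing only finitely many actions. Processes are closed, guarded terms of the grammar $P ::= \mathbf{0} \mid \gamma.P \mid P+P \mid P\|_A P \mid P[\Phi] \mid x \mid \mu x.P$ with $\gamma\in\{\alpha,\underline{\alpha}\}$, $\alpha\in\mathcal{A}_\tau$, $A\subseteq\mathcal{A}$; recursive defining equations ($\equiv$) abbreviate $\mu$-terms, and a trailing $\mathbf 0$ is omitted. $P\|Q$ abbreviates $P\|_{\mathcal{A}\setminus\{\omega\}}Q$. Refusal semantics: transitions $P\xrightarrow{\alpha}_r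 P'$ ($\alpha\in\mathcal{A}_\tau$) and $P\xrightarrow{X}_r P'$ ($X\subseteq\mathcal{A}$) are the least relations closed under: $\alpha.P\xrightarrow{\alpha}_r P$; $\underline{\alpha}.P\xrightarrow{\alpha}_r P$; if $P_1\xrightarrow{\alpha}_r P_1'$ then $P_1+P_2\xrightarrow{\alpha}_r P_1'$ and $P_2+P_1\xrightarrow{\alpha}_r P_1'$; if $\alpha\notin A$ and $P_1\xrightarrow{\alpha}_r P_1'$ then $P_1\|_A P_2\xrightarrow{\alpha}_r P_1'\|_A P_2$ and $P_2\|_A P_1\xrightarrow{\alpha}_r P_2\|_A P_1'$; if $\alpha\in A$, $P_1\xrightarrow{\alpha}_r P_1'$, $P_2\xrightarrow{\alpha}_r P_2'$ then $P_1\|_A P_2\xrightarrow{\alpha}_r P_1'\|_A P_2'$; if $P\xrightarrow{\alpha}_r P'$ then $P[\Phi]\xrightarrow{\Phi(\alpha)}_r P'[\Phi]$; if $P\{\mu x.P/x\}\xrightarrow{\alpha}_r P'$ then $\mu x.P\xrightarrow{\alpha}_r P'$; $\mathbf 0\xrightarrow{X}_r\mathbf 0$; $\alpha.P\xrightarrow{X}_r\underline{\alpha}.P$; if $\alpha\notin X\cup\{\tau\}$ then $\underline{\alpha}.P\xrightarrow{X}_r\underline{\alpha}.P$; if $P_i\xrightarrow{X_i}_r P_i'$ ($i=1,2$) and $X\subseteq (A\cap(X_1\cup X_2))\cup((X_1\cap X_2)\setminus A)$ then $P_1\|_A P_2\xrightarrow{X}_r P_1'\|_A P_2'$; if $P_i\xrightarrow{X}_r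 P_i'$ ($i=1,2$) then $P_1+P_2\xrightarrow{X}_r P_1'+P_2'$; if $P\xrightarrow{\Phi^{ -1}(X\cup\{\tau\})\setminus\{\tau\}}_r P'$ then $P[\Phi]\xrightarrow{X}_r P'[\Phi]$; if $P\{\mu x.P/x\}\xrightarrow{X}_r P'$ then $\mu x.P\xrightarrow{X}_r P'\{\mu x.P/x\}$. A full time step $P\xrightarrow{1}P'$ is $P\xrightarrow{\mathcal{A}}_r P'$. For $w\in(\mathcal{A}_\tau\cup\{1\})^*$, $P\xrightarrow{w}P'$ is the corresponding sequence of action transitions and full time steps; the discrete traces are $DL(P)=\{w/\tau : P\xrightarrow{w}P' \text{ for some } P'\}$ where $w/\tau$ deletes all $\tau$'s; $\zeta(v)$ is the number of $1$'s in $v$. Users: $U_1\equiv\underline{in}.\underline{out}.\underline{\omega}$, $U_n\equiv U_{n-1}\|_{\{\omega\}}\underline{in}.\underline{out}.\underline{\omega}$ for $n>1$. Response performance: $rp_P(n)=\sup\{\zeta(v) : v\in DL(P\|U_n),\ v \text{ does not contain }\omega\}\in\mathbb{N}_0\cup\{\infty\}$. The asymptotic performance of $P$ is the $a\in\mathbb{R}$ with $rp_P(n)=an+\Theta(1)$. -}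

module Defs where

open import Data.Nat using (ℕ; zero; suc; _+_; _*_; _<_; _<?_; _≟_)
open import Data.List using (List; []; _∷_)
open import Data.List.Membership.Propositional using (_∈_; _∉_)
open import Data.Product using (Σ; ∃; ∃-syntax; _×_; _,_)
open import Data.Sum using (_⊎_)
open import Data.Empty using (⊥)
open import Data.Unit using (⊤)
open import Relation.Nullary using (¬_; yes; no)
open import Relation.Binary.PropositionalEquality using (_≡_; _≢_)

data Act : Set where
  ω    : Act
  inA  : Act
  outA : Act
  act  : ℕ → Act

data Actτ : Set where
  τ   : Actτ
  vis : Act → Actτ

ASet : Set₁
ASet = Act → Set

_⊆A_ : ASet → ASet → Set
X ⊆A Y = ∀ a → X a → Y a

_∈τ_ : Actτ → ASet → Set
τ     ∈τ A = ⊥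
vis a ∈τ A = A a

record Relabel : Set where
  field
    Φ      : Actτ → Actτ
    Φτ     : Φ τ ≡ τ
    finite : ∃[ L ] (∀ α → α ∉ L → Φ α ≡ α)

-- Syntax.  Recursion is expressed via process constants  con k  whose
-- defining equations (bodies) are supplied by an environment Δ; this is
-- the "defining equations abbreviate μ-terms" reading.

data Term : Set₁ where
  𝟘    : Term
  pre  : Actτ → Term → Term
  upre : Actτ → Term → Term
  _⊕_  : Term → Term → Term
  par  : Term → ASet → Term → Term
  rel  : Term → Relabel → Term
  con  : ℕ → Term

module Semantics (Δ : ℕ → Term) where

  infix 4 _—[_]→_ _=[_]⇒_

  data _—[_]→_ : Term → Actτ → Term → Set₁ where
    pre→  : ∀ {α P} → pre α P —[ α ]→ P
    upre→ : ∀ {α P} → upre α P —[ α ]→ P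
    sumL→ : ∀ {α P₁ P₂ P₁'} → P₁ —[ α ]→ P₁' → (P₁ ⊕ P₂) —[ α ]→ P₁'
    sumR→ : ∀ {α P₁ P₂ P₁'} → P₁ —[ α ]→ P₁' → (P₂ ⊕ P₁) —[ α ]→ P₁'
    parL→ : ∀ {α A P₁ P₂ P₁'} → ¬ (α ∈τ A) → P₁ —[ α ]→ P₁' →
            par P₁ A P₂ —[ α ]→ par P₁' A P₂
    parR→ : ∀ {α A P₁ P₂ P₁'} → ¬ (α ∈τ A) → P₁ —[ α ]→ P₁' →
            par P₂ A P₁ —[ α ]→ par P₂ A P₁'
    sync→ : ∀ {a A P₁ P₂ P₁' P₂'} → A a →
            P₁ —[ vis a ]→ P₁' → P₂ —[ vis a ]→ P₂' →
            par P₁ A P₂ —[ vis a ]→ par P₁' A P₂'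
    rel→  : ∀ {α P P' Φ} → P —[ α ]→ P' →
            rel P Φ —[ Relabel.Φ Φ α ]→ rel P' Φ
    con→  : ∀ {α k P'} → Δ k —[ α ]→ P' → con k —[ α ]→ P'

  preimg : Relabel → ASet → ASet
  preimg Φ X a = hit (Relabel.Φ Φ (vis a))
    where
    hit : Actτ → Set
    hit τ       = ⊤
    hit (vis b) = X b

  data _=[_]⇒_ : Term → ASet → Term → Set₁ where
    nil⇒  : ∀ {X} → 𝟘 =[ X ]⇒ 𝟘
    pre⇒  : ∀ {X α P} → pre α P =[ X ]⇒ upre α P
    upre⇒ : ∀ {X a P} → ¬ X a → upre (vis a) P =[ X ]⇒ upre (vis a) P
    par⇒  : ∀ {X X₁ X₂ A P₁ P₂ P₁' P₂'} →
            P₁ =[ X₁ ]⇒ P₁' → P₂ =[ X₂ ]⇒ P₂' →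
            X ⊆A (λ a → (A a × (X₁ a ⊎ X₂ a)) ⊎ ((X₁ a × X₂ a) × ¬ A a)) →
            par P₁ A P₂ =[ X ]⇒ par P₁' A P₂'
    sum⇒  : ∀ {X P₁ P₂ P₁' P₂'} → P₁ =[ X ]⇒ P₁' → P₂ =[ X ]⇒ P₂' →
            (P₁ ⊕ P₂) =[ X ]⇒ (P₁' ⊕ P₂')
    rel⇒  : ∀ {X P P' Φ} → P =[ preimg Φ X ]⇒ P' → rel P Φ =[ X ]⇒ rel P' Φ
    con⇒  : ∀ {X k P'} → Δ k =[ X ]⇒ P' → con k =[ X ]⇒ P'

  𝒜 : ASet
  𝒜 _ = ⊤

  data Label : Set where
    lact  : Actτ → Label
    ltick : Label

  data _⟹[_]_ : Term → List Label → Term → Set₁ where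
    done : ∀ {P} → P ⟹[ [] ] P
    stepA : ∀ {P P' P'' α w} → P —[ α ]→ P' → P' ⟹[ w ] P'' →
            P ⟹[ lact α ∷ w ] P''
    stepT : ∀ {P P' P'' w} → P =[ 𝒜 ]⇒ P' → P' ⟹[ w ] P'' →
            P ⟹[ ltick ∷ w ] P''

  data VLabel : Set where
    vact  : Act → VLabel
    vtick : VLabel

  eraseτ : List Label → List VLabel
  eraseτ []               = []
  eraseτ (lact τ ∷ w)     = eraseτ w
  eraseτ (lact (vis a) ∷ w) = vact a ∷ eraseτ w
  eraseτ (ltick ∷ w)      = vtick ∷ eraseτ w

  DL : Term → List VLabel → Set₁
  DL P v = ∃[ w ] ∃[ P' ] (P ⟹[ w ] P' × eraseτ w ≡ v)

  ζ : List VLabel → ℕ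
  ζ []             = 0
  ζ (vtick ∷ v)    = suc (ζ v)
  ζ (vact _ ∷ v)   = ζ v

_∥_ : Term → Term → Term
P ∥ Q = par P (λ a → a ≢ ω) Q

ωset : ASet
ωset a = a ≡ ω

user : Term
user = upre (vis inA) (upre (vis outA) (upre (vis ω) 𝟘))

-- U n for n ≥ 1 (U 0 is never used; set to 0 as a dummy)
U : ℕ → Term
U zero = 𝟘
U (suc zero) = user
U (suc (suc n)) = par (U (suc n)) ωset user

-- Response performance:  rp_P(n) = m  (sup over ω-free discrete traces
-- of P || U_n of ζ, unfolded for a natural-number value m:
-- every such ζ is ≤ m and m is attained).

module _ (Δ : ℕ → Term) where
  open Semantics Δ

  RpIs : Term → ℕ → ℕ → Set₁
  RpIs P n m =
      (∀ v → DL (P ∥ U n) v → vact ω ∉ v → Data.Nat._≤_ (ζ v) m)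
    × (∃[ v ] (DL (P ∥ U n) v × vact ω ∉ v × ζ v ≡ m))

-- The Fifo defining equations for a given N, with Fifo(i) = con i.
--   Fifo(0)   ≡ in.Fifo(1)
--   Fifo(i)   ≡ in.Fifo(i+1) + out.Fifo(i-1)   (0 < i < N+2)
--   Fifo(N+2) ≡ out.Fifo(N+1)
-- (constants with index > N+2 are unreachable; their body is 0)

FifoΔ : ℕ → ℕ → Term
FifoΔ N zero = pre (vis inA) (con 1)
FifoΔ N (suc j) with suc j <? N + 2
... | yes _ = pre (vis inA) (con (suc (suc j))) ⊕ pre (vis outA) (con j)
... | no _ with suc j ≟ N + 2
...   | yes _ = pre (vis outA) (con j)
...   | no _  = 𝟘

Fifo : Term
Fifo = con 0

-- Each user performs exactly two visible actions besides ω, so Fifo ∥ Uₙ has a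
-- budget of 2n visible actions before ω.  After a time step everything is
-- urgent, and with i items buffered either the empty Fifo offers in̲ to a user
-- still waiting to enter, or the nonempty Fifo offers out̲ to one of the i users
-- inside; either way no second time step can pass before a visible action.
-- Hence at most one time step per unit of budget: rp(n) ≤ 2n.  Conversely the
-- users can be served one at a time, with a time step before each in and each
-- out, which realises 2n time steps.
module Submission where

open import Defs
open import Data.Nat using (ℕ; zero; suc; _+_; _*_; _≤_; _<_; z≤n; s≤s; pred; _<?_; _≟_)
open import Data.Nat.Properties
open import Data.Bool using (Bool; true; false)
open import Data.List using (List; []; _∷_)
open import Data.List.Relation.Unary.Any using (here; there)
open import Data.List.Membership.Propositional using (_∉_)
open import Data.Product using (Σ-syntax; _×_; _,_)
open import Data.Sum using (_⊎_; inj₁; inj₂; [_,_]′)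
open import Data.Empty using (⊥; ⊥-elim)
open import Data.Unit using (tt)
open import Function using (_∘_)
open import Relation.Nullary using (¬_; yes; no)
open import Relation.Binary.PropositionalEquality

∉-∷ : {A : Set} {x y : A} {v : List A} → x ≢ y → y ∉ v → y ∉ x ∷ v
∉-∷ x≢y y∉v (here y≡x) = x≢y (sym y≡x)
∉-∷ x≢y y∉v (there y∈v) = y∉v y∈v

∅ : ASet
∅ _ = ⊥

ParRefusal : ASet → ASet → ASet → ASet → Set
ParRefusal A X X₁ X₂ = X ⊆A (λ a → (A a × (X₁ a ⊎ X₂ a)) ⊎ ((X₁ a × X₂ a) × ¬ A a))

refusal-synchronised : ∀ {A X X₁ X₂ a} → ParRefusal A X X₁ X₂ → A a → X a → X₁ a ⊎ X₂ a
refusal-synchronised sub Aa Xa with sub _ Xa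
... | inj₁ (_ , X₁⊎X₂) = X₁⊎X₂
... | inj₂ (_ , ¬Aa) = ⊥-elim (¬Aa Aa)

refusal-interleaved : ∀ {A X X₁ X₂ a} → ParRefusal A X X₁ X₂ → ¬ A a → X a → X₁ a × X₂ a
refusal-interleaved sub ¬Aa Xa with sub _ Xa
... | inj₁ (Aa , _) = ⊥-elim (¬Aa Aa)
... | inj₂ (X₁×X₂ , _) = X₁×X₂

ω-unsynchronised : ¬ (ω ≢ ω)
ω-unsynchronised ω≢ω = ω≢ω refl

module Users (Δ : ℕ → Term) where
  open Semantics Δ

  user-ω user-out : Term
  user-ω   = upre (vis ω) 𝟘
  user-out = upre (vis outA) user-ω

  -- Indices: number of users between in and out, and number of in/out
  -- actions the users still have to perform.
  data Stage : Term → ℕ → ℕ → Set₁ where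
    before-in  : Stage user 0 2
    before-out : Stage user-out 1 1
    before-ω   : Stage user-ω 0 0

  data Population : Term → ℕ → ℕ → Set₁ where
    single : ∀ {t a r} → Stage t a r → Population t a r
    join   : ∀ {t u a r b q} → Population t a r → Stage u b q →
             Population (par t ωset u) (a + b) (r + q)

  population-U : ∀ n → Population (U (suc n)) 0 (2 * suc n)
  population-U zero = single before-in
  population-U (suc n) =
    subst (Population _ 0) (trans (+-comm (2 * suc n) 2) (sym (*-suc 2 (suc n))))
          (join (population-U n) before-in)

  data Effect : Actτ → ℕ → ℕ → ℕ → ℕ → Set where
    enter : ∀ {a r} → Effect (vis inA) a (suc r) (suc a) r
    leave : ∀ {a r} → Effect (vis outA) (suc a) (suc r) a r

  effect-+ʳ : ∀ {α a r a' r'} b q → Effect α a r a' r' → Effect α (a + b) (r + q) (a' + b) (r' + q)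
  effect-+ʳ b q enter = enter
  effect-+ʳ b q leave = leave

  effect-+ˡ : ∀ {α b q b' q'} a r → Effect α b q b' q' → Effect α (a + b) (r + q) (a + b') (r + q')
  effect-+ˡ a r (enter {b} {q}) rewrite +-suc a b | +-suc r q = enter
  effect-+ˡ a r (leave {b} {q}) rewrite +-suc a b | +-suc r q = leave

  data Moved (S : Term → ℕ → ℕ → Set₁) (a r : ℕ) : Actτ → Term → Set₁ where
    success : ∀ {t'} → Moved S a r (vis ω) t'
    consume : ∀ {α t' a' r'} → Effect α a r a' r' → S t' a' r' → Moved S a r α t'

  stage-move : ∀ {t a r α t'} → Stage t a r → t —[ α ]→ t' → Moved Stage a r α t'
  stage-move before-in  upre→ = consume enter before-out
  stage-move before-out upre→ = consume leave before-ω
  stage-move before-ω   upre→ = success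

  population-move : ∀ {t a r α t'} → Population t a r → t —[ α ]→ t' → Moved Population a r α t'
  population-move (single s) t→ with stage-move s t→
  ... | success = success
  ... | consume e s' = consume e (single s')
  population-move (join {b = b} {q = q} p s) (parL→ _ t→) with population-move p t→
  ... | success = success
  ... | consume e p' = consume (effect-+ʳ b q e) (join p' s)
  population-move (join {a = a} {r = r} p s) (parR→ _ t→) with stage-move s t→
  ... | success = success
  ... | consume e s' = consume (effect-+ˡ a r e) (join p s')
  population-move (join p s) (sync→ refl _ _) = success

  record RefusalFacts (X : ASet) (a r : ℕ) : Set where
    field
      refuses-in  : X inA → r ≡ a
      refuses-ω   : X ω → 1 ≤ r
      refuses-out : X outA → a ≡ 0
  open RefusalFacts

  stage-refusal : ∀ {t a r X t'} → Stage t a r → t =[ X ]⇒ t' → t' ≡ t × RefusalFacts X a r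
  stage-refusal before-in (upre⇒ ¬in) =
    refl , record { refuses-in = ⊥-elim ∘ ¬in ; refuses-ω = λ _ → s≤s z≤n ; refuses-out = λ _ → refl }
  stage-refusal before-out (upre⇒ ¬out) =
    refl , record { refuses-in = λ _ → refl ; refuses-ω = λ _ → s≤s z≤n ; refuses-out = ⊥-elim ∘ ¬out }
  stage-refusal before-ω (upre⇒ ¬ω) =
    refl , record { refuses-in = λ _ → refl ; refuses-ω = ⊥-elim ∘ ¬ω ; refuses-out = λ _ → refl }

  population-refusal : ∀ {t a r X t'} → Population t a r → t =[ X ]⇒ t' →
                       Population t' a r × RefusalFacts X a r
  population-refusal (single s) rf with stage-refusal s rf
  ... | refl , facts = single s , facts
  population-refusal (join {r = r} {q = q} p s) (par⇒ rf₁ rf₂ sub)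
    with population-refusal p rf₁ | stage-refusal s rf₂
  ... | p' , f₁ | refl , f₂ = join p' s , record
    { refuses-in  = λ x → both (refuses-in f₁) (refuses-in f₂) (refusal-interleaved sub (λ ()) x)
    ; refuses-ω   = [ (λ x → ≤-trans (refuses-ω f₁ x) (m≤m+n r q))
                    , (λ x → ≤-trans (refuses-ω f₂ x) (m≤n+m q r)) ]′ ∘ refusal-synchronised sub refl
    ; refuses-out = λ x → both (refuses-out f₁) (refuses-out f₂) (refusal-interleaved sub (λ ()) x)
    }
    where
    both : ∀ {P Q : Set} {m n m' n' : ℕ} → (P → m ≡ m') → (Q → n ≡ n') → P × Q → m + n ≡ m' + n'
    both f g (x , y) = cong₂ _+_ (f x) (g y)

  stage-refuses-∅ : ∀ {t a r} → Stage t a r → t =[ ∅ ]⇒ t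
  stage-refuses-∅ before-in  = upre⇒ (λ ())
  stage-refuses-∅ before-out = upre⇒ (λ ())
  stage-refuses-∅ before-ω   = upre⇒ (λ ())

  population-refuses-∅ : ∀ {t a r} → Population t a r → t =[ ∅ ]⇒ t
  population-refuses-∅ (single s) = stage-refuses-∅ s
  population-refuses-∅ (join p s) = par⇒ (population-refuses-∅ p) (stage-refuses-∅ s) (λ _ ())

  stage-refuses-ω : ∀ {t a r} → Stage t a r → 1 ≤ r → t =[ ωset ]⇒ t
  stage-refuses-ω before-in  _ = upre⇒ (λ ())
  stage-refuses-ω before-out _ = upre⇒ (λ ())

  population-refuses-ω : ∀ {t a r} → Population t a r → 1 ≤ r → t =[ ωset ]⇒ t
  population-refuses-ω (single s) 1≤r = stage-refuses-ω s 1≤r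
  population-refuses-ω (join {r = zero} p s) 1≤q =
    par⇒ (population-refuses-∅ p) (stage-refuses-ω s 1≤q) (λ _ refl → inj₁ (refl , inj₂ refl))
  population-refuses-ω (join {r = suc _} p s) _ =
    par⇒ (population-refuses-ω p (s≤s z≤n)) (stage-refuses-∅ s) (λ _ refl → inj₁ (refl , inj₁ refl))

  data UserServed (t : Term) (r : ℕ) : Set₁ where
    served : ∀ {t₁ t₂ r₁ r₂} → r ≡ suc r₁ → r₁ ≡ suc r₂ →
             t —[ vis inA ]→ t₁ → Population t₁ 1 r₁ →
             t₁ —[ vis outA ]→ t₂ → Population t₂ 0 r₂ → UserServed t r

  serve-user : ∀ {t a r} → Population t a r → a ≡ 0 → 1 ≤ r → UserServed t r
  serve-user (single before-in) _ _ = served refl refl upre→ (single before-out) upre→ (single before-ω)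
  serve-user (join {a = a} p s) a+b≡0 1≤r with m+n≡0⇒m≡0 a a+b≡0
  serve-user (join {r = r} p before-in) _ _ | refl =
    served (+-suc r 1) (+-suc r 0) (parR→ (λ ()) upre→) (join p before-out)
                                    (parR→ (λ ()) upre→) (join p before-ω)
  serve-user (join {r = r} p before-ω) _ 1≤r | refl
    with serve-user p refl (subst (1 ≤_) (+-identityʳ r) 1≤r)
  ... | served e₁ e₂ in→ p₁ out→ p₂ =
    served (cong (_+ 0) e₁) (cong (_+ 0) e₂) (parL→ (λ ()) in→) (join p₁ before-ω)
                                             (parL→ (λ ()) out→) (join p₂ before-ω)

prefixed : Bool → Actτ → Term → Term
prefixed false = pre
prefixed true  = upre

module Buffer (N : ℕ) where
  open Semantics (FifoΔ N)
  open Users (FifoΔ N)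
  open RefusalFacts

  capacity : ℕ
  capacity = 2 + N

  -- FifoBody true i F: F is what Fifo(i) becomes after a time step.
  data FifoBody (u : Bool) : ℕ → Term → Set₁ where
    empty  : FifoBody u 0 (prefixed u (vis inA) (con 1))
    middle : ∀ {i} → suc i < capacity →
             FifoBody u (suc i) (prefixed u (vis inA) (con (suc (suc i))) ⊕ prefixed u (vis outA) (con i))
    full   : FifoBody u capacity (prefixed u (vis outA) (con (suc N)))

  fifo-equation : ∀ i → i ≤ capacity → FifoBody false i (FifoΔ N i)
  fifo-equation zero _ = empty
  fifo-equation (suc i) i≤cap with suc i <? N + 2
  ... | yes i<N+2 = middle (subst (suc i <_) (+-comm N 2) i<N+2)
  ... | no i≮N+2 with suc i ≟ N + 2
  ...   | yes i≡N+2 with suc-injective (trans i≡N+2 (+-comm N 2))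
  ...     | refl = full
  fifo-equation (suc i) i≤cap | no i≮N+2 | no i≢N+2 =
    ⊥-elim (i≢N+2 (≤-antisym (subst (suc i ≤_) (+-comm 2 N) i≤cap) (≮⇒≥ i≮N+2)))

  data FifoMove : ℕ → Actτ → Term → Set₁ where
    enqueue : ∀ {i} → i < capacity → FifoMove i (vis inA) (con (suc i))
    dequeue : ∀ {i} → i < capacity → FifoMove (suc i) (vis outA) (con i)

  prefixed-move : ∀ {u α β P Q} → prefixed u α P —[ β ]→ Q → β ≡ α × Q ≡ P
  prefixed-move {false} pre→ = refl , refl
  prefixed-move {true} upre→ = refl , refl

  fifo-move : ∀ {u i F α F'} → FifoBody u i F → F —[ α ]→ F' → FifoMove i α F'
  fifo-move empty t with prefixed-move t
  ... | refl , refl = enqueue (s≤s z≤n)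
  fifo-move (middle i<cap) (sumL→ t) with prefixed-move t
  ... | refl , refl = enqueue i<cap
  fifo-move (middle i<cap) (sumR→ t) with prefixed-move t
  ... | refl , refl = dequeue (<⇒≤ i<cap)
  fifo-move full t with prefixed-move t
  ... | refl , refl = dequeue ≤-refl

  fifo-refusal : ∀ {i F X F'} → FifoBody false i F → F =[ X ]⇒ F' → FifoBody true i F'
  fifo-refusal empty pre⇒ = empty
  fifo-refusal (middle i<cap) (sum⇒ pre⇒ pre⇒) = middle i<cap
  fifo-refusal full pre⇒ = full

  fifo-idles : ∀ {i F X} → FifoBody false i F → Σ[ F' ∈ Term ] (F =[ X ]⇒ F') × FifoBody true i F'
  fifo-idles empty = _ , pre⇒ , empty
  fifo-idles (middle i<cap) = _ , sum⇒ pre⇒ pre⇒ , middle i<cap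
  fifo-idles full = _ , pre⇒ , full

  urgent-empty-offers-in : ∀ {F X F'} → FifoBody true 0 F → F =[ X ]⇒ F' → ¬ X inA
  urgent-empty-offers-in empty (upre⇒ ¬in) = ¬in

  urgent-nonempty-offers-out : ∀ {i F X F'} → FifoBody true (suc i) F → F =[ X ]⇒ F' → ¬ X outA
  urgent-nonempty-offers-out (middle _) (sum⇒ _ (upre⇒ ¬out)) = ¬out
  urgent-nonempty-offers-out full (upre⇒ ¬out) = ¬out

  urgent-empty-in : ∀ {F} → FifoBody true 0 F → F —[ vis inA ]→ con 1
  urgent-empty-in empty = upre→

  urgent-nonempty-out : ∀ {i F} → FifoBody true (suc i) F → F —[ vis outA ]→ con i
  urgent-nonempty-out (middle _) = sumR→ upre→
  urgent-nonempty-out full = upre→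

  -- The buffer holds exactly the items of the users between in and out.
  data Lazy : Term → ℕ → Set₁ where
    lazy : ∀ {i T r} → i ≤ capacity → Population T i r → Lazy (con i ∥ T) r

  data Urgent : Term → ℕ → Set₁ where
    urgent : ∀ {i F T r} → FifoBody true i F → Population T i r → Urgent (F ∥ T) r

  data SystemMove : ℕ → Actτ → Term → Set₁ where
    success  : ∀ {r Q} → SystemMove r (vis ω) Q
    progress : ∀ {r a Q} → Lazy Q r → SystemMove (suc r) (vis a) Q

  system-move : ∀ {i F T r α Q} → (∀ {β F'} → F —[ β ]→ F' → FifoMove i β F') →
                Population T i r → (F ∥ T) —[ α ]→ Q → SystemMove r α Q
  system-move fifo p (parL→ ¬sync t) with fifo t
  ... | enqueue _ = ⊥-elim (¬sync (λ ()))
  ... | dequeue _ = ⊥-elim (¬sync (λ ()))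
  system-move fifo p (parR→ ¬sync t) with population-move p t
  ... | success = success
  ... | consume enter _ = ⊥-elim (¬sync (λ ()))
  ... | consume leave _ = ⊥-elim (¬sync (λ ()))
  system-move fifo p (sync→ _ t₁ t₂) with fifo t₁ | population-move p t₂
  ... | _ | success = success
  ... | enqueue i<cap | consume enter p' = progress (lazy i<cap p')
  ... | dequeue i<cap | consume leave p' = progress (lazy (<⇒≤ i<cap) p')

  lazy-move : ∀ {P r α Q} → Lazy P r → P —[ α ]→ Q → SystemMove r α Q
  lazy-move (lazy {i} i≤cap p) = system-move (λ { (con→ t) → fifo-move (fifo-equation i i≤cap) t }) p

  urgent-move : ∀ {P r α Q} → Urgent P r → P —[ α ]→ Q → SystemMove r α Q
  urgent-move (urgent F p) = system-move (fifo-move F) p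

  lazy-tick : ∀ {P r Q} → Lazy P r → P =[ 𝒜 ]⇒ Q → 1 ≤ r × Urgent Q r
  lazy-tick (lazy {i} i≤cap p) (par⇒ (con⇒ rf₁) rf₂ sub) with population-refusal p rf₂
  ... | p' , facts with refusal-interleaved sub ω-unsynchronised tt
  ...   | _ , ω∈X₂ = refuses-ω facts ω∈X₂ , urgent (fifo-refusal (fifo-equation i i≤cap) rf₁) p'

  -- Empty: the users refuse ω and in, so they owe nothing, yet refusing ω needs
  -- a positive budget.  Nonempty: refusing out needs nobody inside.
  urgent-cannot-tick : ∀ {P r Q} → Urgent P r → ¬ (P =[ 𝒜 ]⇒ Q)
  urgent-cannot-tick (urgent {zero} F p) (par⇒ rf₁ rf₂ sub) with population-refusal p rf₂
  ... | _ , facts with refusal-interleaved sub ω-unsynchronised tt | refusal-synchronised sub (λ ()) tt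
  ...   | _ , _ | inj₁ in∈X₁ = urgent-empty-offers-in F rf₁ in∈X₁
  ...   | _ , ω∈X₂ | inj₂ in∈X₂ with refuses-ω facts ω∈X₂ | refuses-in facts in∈X₂
  ...     | s≤s _ | ()
  urgent-cannot-tick (urgent {suc i} F p) (par⇒ rf₁ rf₂ sub) with population-refusal p rf₂
  ... | _ , facts with refusal-synchronised sub (λ ()) tt
  ...   | inj₁ out∈X₁ = urgent-nonempty-offers-out F rf₁ out∈X₁
  ...   | inj₂ out∈X₂ with refuses-out facts out∈X₂
  ...     | ()

  lazy-bound : ∀ {P r w P'} → Lazy P r → P ⟹[ w ] P' → vact ω ∉ eraseτ w → ζ (eraseτ w) ≤ r
  urgent-bound : ∀ {P r w P'} → Urgent P r → P ⟹[ w ] P' → vact ω ∉ eraseτ w → ζ (eraseτ w) ≤ pred r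

  lazy-bound S done _ = z≤n
  lazy-bound S (stepA t rest) ω∉ with lazy-move S t
  ... | success = ⊥-elim (ω∉ (here refl))
  ... | progress S' = m≤n⇒m≤1+n (lazy-bound S' rest (ω∉ ∘ there))
  lazy-bound S (stepT tick rest) ω∉ with lazy-tick S tick
  ... | s≤s z≤n , S' = s≤s (urgent-bound S' rest (ω∉ ∘ there))

  urgent-bound S done _ = z≤n
  urgent-bound S (stepA t rest) ω∉ with urgent-move S t
  ... | success = ⊥-elim (ω∉ (here refl))
  ... | progress S' = lazy-bound S' rest (ω∉ ∘ there)
  urgent-bound S (stepT tick rest) _ = ⊥-elim (urgent-cannot-tick S tick)

  -- The lazy buffer refuses everything, so the time step only needs the users to refuse ω.
  lazy-idles : ∀ {i T r} → i ≤ capacity → Population T i r → 1 ≤ r →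
               Σ[ F ∈ Term ] ((con i ∥ T) =[ 𝒜 ]⇒ (F ∥ T)) × FifoBody true i F
  lazy-idles {i} i≤cap p 1≤r with fifo-idles (fifo-equation i i≤cap)
  ... | F , rf , F-urgent = F , par⇒ (con⇒ rf) (population-refuses-ω p 1≤r) split , F-urgent
    where
    split : ParRefusal (λ a → a ≢ ω) 𝒜 𝒜 ωset
    split ω       _ = inj₂ ((tt , refl) , ω-unsynchronised)
    split inA     _ = inj₁ ((λ ()) , inj₁ tt)
    split outA    _ = inj₁ ((λ ()) , inj₁ tt)
    split (act _) _ = inj₁ ((λ ()) , inj₁ tt)

  serve-round : ∀ {T r} → Population T 0 r → 1 ≤ r →
                Σ[ T' ∈ Term ] Σ[ r' ∈ ℕ ] r ≡ 2 + r' × Population T' 0 r' ×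
                (∀ {w P'} → (con 0 ∥ T') ⟹[ w ] P' →
                   (con 0 ∥ T) ⟹[ ltick ∷ lact (vis inA) ∷ ltick ∷ lact (vis outA) ∷ w ] P')
  serve-round p 1≤r with serve-user p refl 1≤r
  ... | served {r₂ = r₂} refl refl in→ p₁ out→ p₂ with lazy-idles z≤n p 1≤r | lazy-idles (s≤s z≤n) p₁ (s≤s z≤n)
  ...   | F₀ , tick₀ , F₀-urgent | F₁ , tick₁ , F₁-urgent =
    _ , r₂ , refl , p₂ , λ rest →
      stepT tick₀ (stepA (sync→ (λ ()) (urgent-empty-in F₀-urgent) in→)
        (stepT tick₁ (stepA (sync→ (λ ()) (urgent-nonempty-out F₁-urgent) out→) rest)))

  serve-all : ∀ m {T} → Population T 0 (2 * m) →
              Σ[ w ∈ List Label ] Σ[ P' ∈ Term ]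
                ((con 0 ∥ T) ⟹[ w ] P') × vact ω ∉ eraseτ w × ζ (eraseτ w) ≡ 2 * m
  serve-all zero p = [] , _ , done , (λ ()) , refl
  serve-all (suc m) p rewrite *-suc 2 m with serve-round p (s≤s z≤n)
  ... | T' , r' , refl , p' , prepend with serve-all m p'
  ...   | w , P' , run , ω∉ , ζ≡ =
    _ , P' , prepend run , ∉-∷ (λ ()) (∉-∷ (λ ()) (∉-∷ (λ ()) (∉-∷ (λ ()) ω∉))) , cong (2 +_) ζ≡

proposition1 : (N : ℕ) → 1 ≤ N → (n : ℕ) → 1 ≤ n → RpIs (FifoΔ N) Fifo n (2 * n)
proposition1 N _ zero ()
proposition1 N _ (suc n) _ = upper , lower
  where
  open Semantics (FifoΔ N)
  open Users (FifoΔ N)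
  open Buffer N
  upper : ∀ v → DL (Fifo ∥ U (suc n)) v → vact ω ∉ v → ζ v ≤ 2 * suc n
  upper _ (_ , _ , run , refl) = lazy-bound (lazy z≤n (population-U n)) run
  lower : Σ[ v ∈ List VLabel ] DL (Fifo ∥ U (suc n)) v × vact ω ∉ v × ζ v ≡ 2 * suc n
  lower with serve-all (suc n) (population-U n)
  ... | w , P' , run , ω∉ , ζ≡ = eraseτ w , (w , P' , run , refl) , ω∉ , ζ≡
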